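{- Consider the nodes $v_1,\dots,v_9$ with the following gates (in the gate semantics described in the context): $\textsc{Purify}$ gate $(v_1,v_2,v_3)$ (input $v_1$, outputs $v_2,v_3$); $\textsc{Nor}$ gate $(v_2,v_3,v_4)$ (inputs $v_2,v_3$, output $v_4$); $\textsc{Purify}$ gate $(v_4,v_5,v_1)$ (input $v_4$, outputs $v_5,v_1$); $\textsc{Purify}$ gate $(v_5,v_6,v_7)$ (input $v_5$, outputs $v_6,v_7$); $\textsc{Nor}$ gate $(v_6,v_7,v_8)$ (inputs $v_6,v_7$, output $v_8$); $\textsc{Nor}$ gate $(v_5,v_8,v_9)$ (inputs $v_5,v_8$, output $v_9$). Then for every assignment $b:\{v_1,\dots,v_9\}\to\{0,1,\bot\}$ that satisfies all these gates, it holds that $b(v_9)=0$.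
   Context: An assignment $b$ satisfies a $\textsc{Nor}$ gate with inputs $u,v$ and output $w$ if $b(u)=b(v)=0\implies b(w)=1$ and ($b(u)=1$ or $b(v)=1$)$\implies b(w)=0$. It satisfies a $\textsc{Purify}$ gate with input $u$ and outputs $v,w$ if $\{b(v),b(w)\}\cap\{0,1\}\neq\emptyset$ and $b(u)\in\{0,1\}\implies b(v)=b(w)=b(u)$. -}

module Defs where

open import Data.Fin using (Fin)
open import Data.Sum using (_⊎_)
open import Data.Product using (_×_)
open import Relation.Binary.PropositionalEquality using (_≡_)

data Val : Set where
  v0 v1 vbot : Val

IsPure : Val → Set
IsPure x = (x ≡ v0) ⊎ (x ≡ v1)

NorSat : Val → Val → Val → Set
NorSat u v w =
  ((u ≡ v0) × (v ≡ v0) → w ≡ v1) ×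
  ((u ≡ v1) ⊎ (v ≡ v1) → w ≡ v0)

PurifySat : Val → Val → Val → Set
PurifySat u v w =
  (IsPure v ⊎ IsPure w) ×
  (IsPure u → (v ≡ u) × (w ≡ u))

-- Nodes v₁..v₉ as Fin 9 (node vᵢ is index i-1).
Assignment : Set
Assignment = Fin 9 → Val

AllGatesSat : Assignment → Set
AllGatesSat b =
  PurifySat (b (# 0)) (b (# 1)) (b (# 2)) ×
  NorSat    (b (# 1)) (b (# 2)) (b (# 3)) ×
  PurifySat (b (# 3)) (b (# 4)) (b (# 0)) ×
  PurifySat (b (# 4)) (b (# 5)) (b (# 6)) ×
  NorSat    (b (# 5)) (b (# 6)) (b (# 7)) ×
  NorSat    (b (# 4)) (b (# 7)) (b (# 8))
  where open import Data.Fin using (#_)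

{-# OPTIONS --safe #-}
-- The gates v₁ → (v₂, v₃) → v₄ → (v₅, v₁) form a loop that forces v₅ to be
-- pure: if v₄ is pure, Purify copies it to v₅; if v₄ = ⊥, Purify makes v₅ or
-- v₁ pure, and a pure v₁ would propagate through Purify and Nor to a pure v₄.
-- Once v₅ = x is pure, v₆ = v₇ = x, so v₈ = ¬x and v₉ = Nor(x, ¬x) = 0.
module Submission where

open import Defs
open import Data.Empty using (⊥-elim)
open import Data.Fin using (#_)
open import Data.Product using (_×_; _,_; proj₁; proj₂)
open import Data.Sum using (_⊎_; inj₁; inj₂)
open import Relation.Nullary using (¬_)
open import Relation.Binary.PropositionalEquality using (_≡_; refl; sym; subst; subst₂)

¬IsPure-vbot : ¬ IsPure vbot
¬IsPure-vbot (inj₁ ())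
¬IsPure-vbot (inj₂ ())

IsPure-or-vbot : (x : Val) → IsPure x ⊎ x ≡ vbot
IsPure-or-vbot v0   = inj₁ (inj₁ refl)
IsPure-or-vbot v1   = inj₁ (inj₂ refl)
IsPure-or-vbot vbot = inj₂ refl

PurifySat-pure-outputs : ∀ {u v w} → PurifySat u v w → IsPure u → IsPure v × IsPure w
PurifySat-pure-outputs (_ , copy) pu =
  let v≡u , w≡u = copy pu
  in subst IsPure (sym v≡u) pu , subst IsPure (sym w≡u) pu

NorSat-pure : ∀ {u v w} → NorSat u v w → IsPure u → IsPure v → IsPure w
NorSat-pure (_ , one-in)  (inj₂ refl) _           = inj₁ (one-in (inj₁ refl))
NorSat-pure (_ , one-in)  (inj₁ refl) (inj₂ refl) = inj₁ (one-in (inj₂ refl))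
NorSat-pure (zero-in , _) (inj₁ refl) (inj₁ refl) = inj₂ (zero-in (refl , refl))

purify-nor-purify-loop-pure : ∀ {a₁ a₂ a₃ a₄ a₅} →
  PurifySat a₁ a₂ a₃ → NorSat a₂ a₃ a₄ → PurifySat a₄ a₅ a₁ → IsPure a₅
purify-nor-purify-loop-pure {a₄ = a₄} p₁ n p₂ with IsPure-or-vbot a₄
... | inj₁ pure₄ = proj₁ (PurifySat-pure-outputs p₂ pure₄)
... | inj₂ refl with proj₁ p₂
...   | inj₁ pure₅ = pure₅
...   | inj₂ pure₁ =
  let pure₂ , pure₃ = PurifySat-pure-outputs p₁ pure₁
  in ⊥-elim (¬IsPure-vbot (NorSat-pure n pure₂ pure₃))

nor-self-nor≡v0 : ∀ {x y z} → IsPure x → NorSat x x y → NorSat x y z → z ≡ v0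
nor-self-nor≡v0 (inj₂ refl) _             (_ , one-in) = one-in (inj₁ refl)
nor-self-nor≡v0 (inj₁ refl) (zero-in , _) (_ , one-in) = one-in (inj₂ (zero-in (refl , refl)))

mainTheorem8 : (b : Assignment) → AllGatesSat b → b (# 8) ≡ v0
mainTheorem8 b (p₁ , n₁ , p₂ , p₃ , n₂ , n₃) =
  let pure₅ = purify-nor-purify-loop-pure p₁ n₁ p₂
      v₆≡v₅ , v₇≡v₅ = proj₂ p₃ pure₅
  in nor-self-nor≡v0 pure₅ (subst₂ (λ u v → NorSat u v (b (# 7))) v₆≡v₅ v₇≡v₅ n₂) n₃
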